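{- The set $\mathfrak{S}_n(2413,4213)$ is invariant under the MFS-action: for every $\pi\in\mathfrak{S}_n(2413,4213)$ and every $x\in[n]$, $\varphi'_x(\pi)\in\mathfrak{S}_n(2413,4213)$.
   Context: $\mathfrak{S}_n$ is the set of permutations of $[n]$; $\mathfrak{S}_n(2413,4213)$ is the set of those containing no subsequence order-isomorphic to $2413$ or to $4213$. With the convention $\pi_0=\pi_{n+1}=-\infty$, a value $\pi_i$ is a double ascent (resp. double descent, peak, valley) of $\pi$ if $\pi_{i-1}<\pi_i<\pi_{i+1}$ (resp. $\pi_{i-1}>\pi_i>\pi_{i+1}$, $\pi_{i-1}<\pi_i>\pi_{i+1}$, $\pi_{i-1}>\pi_i<\pi_{i+1}$). For $x\in[n]$, the $x$-factorization of $\pi$ is $\pi=w_1w_2xw_3w_4$ where $w_2$ (resp. $w_3$) is the maximal contiguous factor (possibly empty) immediately to the left (resp. right) of $x$ all of whose letters exceed $x$; $\varphi_x(\pi)=w_1w_3xw_2w_4$. Then $\varphi'_x(\pi)=\varphi_x(\pi)$ if $x$ is a double ascent or double descent of $\pi$, and $\varphi'_x(\pi)=\pi$ otherwise. The MFS-action is the $\mathbb{Z}_2^n$-action generated by the commuting involutions $\varphi'_x$, $x\in[n]$. -}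

module Defs where

open import Data.Nat using (ℕ; zero; suc; _<_; _<?_; _≟_)
open import Data.Bool using (Bool; true; false; _∧_; _∨_; if_then_else_)
open import Data.Maybe using (Maybe; just; nothing)
open import Data.List using (List; []; _∷_; _++_; reverse; takeWhile; dropWhile; map; upTo; length)
open import Data.List.Relation.Binary.Permutation.Propositional using (_↭_)
open import Data.List.Relation.Binary.Sublist.Propositional using (_⊆_)
open import Data.List.Relation.Binary.Pointwise using (Pointwise)
open import Data.Product using (_×_; ∃)
open import Function.Bundles using (_⇔_)
open import Relation.Nullary using (¬_; ¬?)
open import Relation.Nullary.Decidable using (⌊_⌋)
open import Relation.Binary.PropositionalEquality using (_≡_)

[1‥_] : ℕ → List ℕ
[1‥ n ] = map suc (upTo n)

IsPerm : ℕ → List ℕ → Set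
IsPerm n π = π ↭ [1‥ n ]

OrderIso : List ℕ → List ℕ → Set
OrderIso []      []      = Data.Unit.⊤ where import Data.Unit
OrderIso []      (_ ∷ _) = Data.Empty.⊥ where import Data.Empty
OrderIso (_ ∷ _) []      = Data.Empty.⊥ where import Data.Empty
OrderIso (a ∷ p) (b ∷ s) =
  Pointwise (λ a′ b′ → ((a < a′) ⇔ (b < b′)) × ((a′ < a) ⇔ (b′ < b))) p s
  × OrderIso p s

Contains : List ℕ → List ℕ → Set
Contains p π = ∃ λ σ → σ ⊆ π × OrderIso p σ

Av-2413-4213 : List ℕ → Set
Av-2413-4213 π = ¬ Contains (2 ∷ 4 ∷ 1 ∷ 3 ∷ []) π × ¬ Contains (4 ∷ 2 ∷ 1 ∷ 3 ∷ []) π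

_<ᵇ_ : ℕ → ℕ → Bool
a <ᵇ b = ⌊ a <? b ⌋

before : ℕ → List ℕ → List ℕ
before x π = takeWhile (λ y → ¬? (y ≟ x)) π

after : ℕ → List ℕ → Maybe (List ℕ)
after x π with dropWhile (λ y → ¬? (y ≟ x)) π
... | []       = nothing
... | _ ∷ post = just post

lastM : List ℕ → Maybe ℕ
lastM []           = nothing
lastM (a ∷ [])     = just a
lastM (_ ∷ b ∷ as) = lastM (b ∷ as)

headM : List ℕ → Maybe ℕ
headM []      = nothing
headM (a ∷ _) = just a

-- comparisons with the convention that a missing neighbour is -∞
-- (-∞ < v) for v a letter
lt-∞ : Maybe ℕ → ℕ → Bool
lt-∞ nothing  v = true
lt-∞ (just u) v = u <ᵇ v
gt-∞ : Maybe ℕ → ℕ → Bool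
gt-∞ nothing  v = false
gt-∞ (just u) v = v <ᵇ u

isDoubleAscent : ℕ → List ℕ → Bool
isDoubleAscent x π with after x π
... | nothing   = false
... | just post = lt-∞ (lastM (before x π)) x ∧ gt-∞ (headM post) x

isDoubleDescent : ℕ → List ℕ → Bool
isDoubleDescent x π with after x π
... | nothing   = false
... | just post = gt-∞ (lastM (before x π)) x ∧ lt-∞ (headM post) x

φ : ℕ → List ℕ → List ℕ
φ x π with after x π
... | nothing   = π
... | just post =
  let pre = before x π
      w₂  = reverse (takeWhile (λ y → x <? y) (reverse pre))
      w₁  = reverse (dropWhile (λ y → x <? y) (reverse pre))
      w₃  = takeWhile (λ y → x <? y) post
      w₄  = dropWhile (λ y → x <? y) post
  in w₁ ++ w₃ ++ x ∷ w₂ ++ w₄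

φ′ : ℕ → List ℕ → List ℕ
φ′ x π = if isDoubleAscent x π ∨ isDoubleDescent x π then φ x π else π

-- Both 2413 and 4213 are the words a b c d in which c lies below a and b and d lies strictly
-- between a and b.  At a double ascent (descent) x, φ′_x moves x to the right (left) over the
-- maximal block of larger letters next to it, and the letter just beyond that block, if any,
-- is smaller than x.  So an occurrence in φ′_x(π) that involves x and a block letter either
-- has x as its letter c, which the smaller letter beyond the block can replace, or has x and
-- a block letter as its first two letters, which swaps between 2413 and 4213 when x is put back.

module Submission where

open import Defs
open import Data.Bool using (true; false; _∧_; _∨_; if_then_else_)
open import Data.Bool.Properties using (T-≡)
open import Data.Empty using (⊥-elim)
open import Data.List using (List; []; _∷_; _++_; reverse; takeWhile; dropWhile; initLast; _∷ʳ′_)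
open import Data.List.Properties
  using (takeWhile++dropWhile; reverse-++; reverse-involutive; unfold-reverse; ++-identityʳ; ++-assoc; ∷-injectiveˡ)
open import Data.List.Relation.Binary.Permutation.Propositional using (_↭_; ↭-refl; ↭-sym; ↭-trans)
open import Data.List.Relation.Binary.Permutation.Propositional.Properties
  using (shift; ++⁺ˡ; ↭-reverse; All-resp-↭)
open import Data.List.Relation.Binary.Pointwise using ([]; _∷_)
open import Data.List.Relation.Binary.Sublist.Propositional using (_⊆_; []; _∷_; _∷ʳ_; minimum)
open import Data.List.Relation.Binary.Sublist.Propositional.Properties
  using (++⁺; ∷ʳ⁻; reverse⁺; reverse⁻; All-resp-⊆)
open import Data.List.Relation.Unary.All using (All; []; _∷_)
open import Data.List.Relation.Unary.All.Properties using (all-takeWhile)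
open import Data.Maybe using (just; nothing)
open import Data.Nat using (ℕ; _≤_; _<_; _<?_; _≟_)
open import Data.Nat.Properties using (<-trans; <-asym; ≤-<-trans; ≮⇒≥; ≤⇒≯)
open import Data.Product using (_×_; _,_; ∃; ∃₂)
import Data.Product as Product
open import Data.Sum using (_⊎_; inj₁; inj₂)
import Data.Sum as Sum
open import Data.Unit using (tt)
open import Function using (_∘_)
open import Function.Bundles using (_⇔_; mk⇔; Equivalence)
open import Relation.Binary.PropositionalEquality
  using (_≡_; refl; sym; trans; cong; cong₂; subst; subst₂; module ≡-Reasoning)
open import Relation.Nullary using (¬_; ¬?; yes; no)
open import Relation.Nullary.Decidable using (True; toWitness; decidable-stable)
open import Relation.Unary using (Pred; Decidable)

module _ {a} {A : Set a} where

  ⊆-++⁻ : ∀ xs {ys ws : List A} → ws ⊆ xs ++ ys →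
          ∃₂ λ ws₁ ws₂ → ws ≡ ws₁ ++ ws₂ × ws₁ ⊆ xs × ws₂ ⊆ ys
  ⊆-++⁻ []       p         = [] , _ , refl , [] , p
  ⊆-++⁻ (x ∷ xs) (.x ∷ʳ p) with ⊆-++⁻ xs p
  ... | ws₁ , ws₂ , refl , p₁ , p₂ = ws₁ , ws₂ , refl , x ∷ʳ p₁ , p₂
  ⊆-++⁻ (x ∷ xs) (refl ∷ p) with ⊆-++⁻ xs p
  ... | ws₁ , ws₂ , refl , p₁ , p₂ = x ∷ ws₁ , ws₂ , refl , refl ∷ p₁ , p₂

  ⊆-∷ʳ⁻ : ∀ {xs ys : List A} {y z} → ¬ y ≡ z → xs ++ y ∷ [] ⊆ ys ++ z ∷ [] → xs ++ y ∷ [] ⊆ ys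
  ⊆-∷ʳ⁻ {xs} {ys} {y} {z} y≢z p =
    reverse⁻ (subst (_⊆ reverse ys) (sym (reverse-∷ʳ xs y))
      (∷ʳ⁻ y≢z (subst₂ _⊆_ (reverse-∷ʳ xs y) (reverse-∷ʳ ys z) (reverse⁺ p))))
    where
    reverse-∷ʳ : ∀ ws w → reverse (ws ++ w ∷ []) ≡ w ∷ reverse ws
    reverse-∷ʳ ws w = reverse-++ ws (w ∷ [])

  module _ {p} {P : Pred A p} (P? : Decidable P) where

    takeWhileʳ dropWhileʳ : List A → List A
    takeWhileʳ xs = reverse (takeWhile P? (reverse xs))
    dropWhileʳ xs = reverse (dropWhile P? (reverse xs))

    dropWhileʳ++takeWhileʳ : ∀ xs → dropWhileʳ xs ++ takeWhileʳ xs ≡ xs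
    dropWhileʳ++takeWhileʳ xs = begin
      reverse (dropWhile P? (reverse xs)) ++ reverse (takeWhile P? (reverse xs))
        ≡⟨ sym (reverse-++ (takeWhile P? (reverse xs)) (dropWhile P? (reverse xs))) ⟩
      reverse (takeWhile P? (reverse xs) ++ dropWhile P? (reverse xs))
        ≡⟨ cong reverse (takeWhile++dropWhile P? (reverse xs)) ⟩
      reverse (reverse xs)
        ≡⟨ reverse-involutive xs ⟩
      xs ∎
      where open ≡-Reasoning

    takeWhile-reject : ∀ {x} xs → ¬ P x → takeWhile P? (x ∷ xs) ≡ []
    takeWhile-reject {x} xs ¬px with P? x
    ... | yes px = ⊥-elim (¬px px)
    ... | no _   = refl

    dropWhile-head : ∀ xs {y ys} → dropWhile P? xs ≡ y ∷ ys → ¬ P y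
    dropWhile-head (x ∷ xs) eq with P? x
    ... | yes _  = dropWhile-head xs eq
    ... | no ¬px = subst (λ z → ¬ P z) (∷-injectiveˡ eq) ¬px

lastM-∷ʳ : ∀ xs (y : ℕ) → lastM (xs ++ y ∷ []) ≡ just y
lastM-∷ʳ []           y = refl
lastM-∷ʳ (_ ∷ [])     y = refl
lastM-∷ʳ (_ ∷ z ∷ xs) y = lastM-∷ʳ (z ∷ xs) y

lastM≡headM∘reverse : ∀ xs → lastM xs ≡ headM (reverse xs)
lastM≡headM∘reverse xs with initLast xs
... | []        = refl
... | ys ∷ʳ′ y  = trans (lastM-∷ʳ ys y) (cong headM (sym (reverse-++ ys (y ∷ []))))

data StartsAtMost (x : ℕ) : List ℕ → Set where
  []  : StartsAtMost x []
  _∷_ : ∀ {y} → y ≤ x → ∀ v → StartsAtMost x (y ∷ v)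

data EndsAtMost (x : ℕ) : List ℕ → Set where
  []   : EndsAtMost x []
  _∷ʳ_ : ∀ u {z} → z ≤ x → EndsAtMost x (u ++ z ∷ [])

StartsAtMost-reverse : ∀ {x v} → StartsAtMost x v → EndsAtMost x (reverse v)
StartsAtMost-reverse []         = []
StartsAtMost-reverse (y≤x ∷ v) = subst (EndsAtMost _) (sym (unfold-reverse _ v)) (reverse v ∷ʳ y≤x)

StartsAtMost-dropWhile : ∀ x v → StartsAtMost x (dropWhile (x <?_) v)
StartsAtMost-dropWhile x v with dropWhile (x <?_) v in eq
... | []     = []
... | y ∷ ys = ≮⇒≥ (dropWhile-head (x <?_) v eq) ∷ ys

takeWhile-above≡[] : ∀ x v → lt-∞ (headM v) x ≡ true → takeWhile (x <?_) v ≡ []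
takeWhile-above≡[] x []      _   = refl
takeWhile-above≡[] x (y ∷ v) y<x =
  takeWhile-reject (x <?_) v (<-asym (toWitness (Equivalence.from T-≡ y<x)))

data Hop (x : ℕ) : List ℕ → List ℕ → Set where
  stay  : ∀ {π} → Hop x π π
  right : ∀ u B v → All (x <_) B → StartsAtMost x v → Hop x (u ++ x ∷ B ++ v) (u ++ B ++ x ∷ v)
  left  : ∀ u B v → All (x <_) B → EndsAtMost x u → Hop x (u ++ B ++ x ∷ v) (u ++ x ∷ B ++ v)

Hop⇒↭ : ∀ {x π ρ} → Hop x π ρ → ρ ↭ π
Hop⇒↭     stay               = ↭-refl
Hop⇒↭ {x} (right u B v _ _) = ++⁺ˡ u (shift x B v)
Hop⇒↭ {x} (left u B v _ _)  = ++⁺ˡ u (↭-sym (shift x B v))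

exchange : ℕ → List ℕ → List ℕ → List ℕ
exchange x pre post =
  dropWhileʳ (x <?_) pre ++ takeWhile (x <?_) post ++ x ∷ takeWhileʳ (x <?_) pre ++ dropWhile (x <?_) post

hop-right : ∀ x pre post → lt-∞ (lastM pre) x ≡ true → Hop x (pre ++ x ∷ post) (exchange x pre post)
hop-right x pre post pre<x =
  subst₂ (Hop x) π≡ ρ≡ (right pre B v (all-takeWhile (x <?_) post) (StartsAtMost-dropWhile x post))
  where
  B = takeWhile (x <?_) post
  v = dropWhile (x <?_) post
  no-block : takeWhileʳ (x <?_) pre ≡ []
  no-block = cong reverse
    (takeWhile-above≡[] x (reverse pre) (subst (λ m → lt-∞ m x ≡ true) (lastM≡headM∘reverse pre) pre<x))
  pre-intact : dropWhileʳ (x <?_) pre ≡ pre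
  pre-intact = trans (sym (++-identityʳ _))
    (subst (λ w → dropWhileʳ (x <?_) pre ++ w ≡ pre) no-block (dropWhileʳ++takeWhileʳ (x <?_) pre))
  π≡ : pre ++ x ∷ B ++ v ≡ pre ++ x ∷ post
  π≡ = cong (λ w → pre ++ x ∷ w) (takeWhile++dropWhile (x <?_) post)
  ρ≡ : pre ++ B ++ x ∷ v ≡ exchange x pre post
  ρ≡ = cong₂ (λ w₁ w₂ → w₁ ++ B ++ x ∷ w₂ ++ v) (sym pre-intact) (sym no-block)

hop-left : ∀ x pre post → lt-∞ (headM post) x ≡ true → Hop x (pre ++ x ∷ post) (exchange x pre post)
hop-left x pre post x>post =
  subst₂ (Hop x) π≡ ρ≡ (left u B post B>x (StartsAtMost-reverse (StartsAtMost-dropWhile x (reverse pre))))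
  where
  u = dropWhileʳ (x <?_) pre
  B = takeWhileʳ (x <?_) pre
  B>x : All (x <_) B
  B>x = All-resp-↭ (↭-sym (↭-reverse _)) (all-takeWhile (x <?_) (reverse pre))
  π≡ : u ++ B ++ x ∷ post ≡ pre ++ x ∷ post
  π≡ = trans (sym (++-assoc u B (x ∷ post))) (cong (_++ x ∷ post) (dropWhileʳ++takeWhileʳ (x <?_) pre))
  no-block : takeWhile (x <?_) post ≡ []
  no-block = takeWhile-above≡[] x post x>post
  post-intact : dropWhile (x <?_) post ≡ post
  post-intact = subst (λ w → w ++ dropWhile (x <?_) post ≡ post) no-block (takeWhile++dropWhile (x <?_) post)
  ρ≡ : u ++ x ∷ B ++ post ≡ exchange x pre post
  ρ≡ = cong₂ (λ w₃ w₄ → u ++ w₃ ++ x ∷ B ++ w₄) (sym no-block) (sym post-intact)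

hop-exchange : ∀ x pre post →
  (lt-∞ (lastM pre) x ∧ gt-∞ (headM post) x) ∨ (gt-∞ (lastM pre) x ∧ lt-∞ (headM post) x) ≡ true →
  Hop x (pre ++ x ∷ post) (exchange x pre post)
hop-exchange x pre post _ with lt-∞ (lastM pre) x in pre<x | lt-∞ (headM post) x in x>post | gt-∞ (lastM pre) x
... | true  | _     | _    = hop-right x pre post pre<x
... | false | true  | _    = hop-left x pre post x>post
hop-exchange x pre post () | false | false | true
hop-exchange x pre post () | false | false | false

before++x∷after : ∀ x π {post} → after x π ≡ just post → before x π ++ x ∷ post ≡ π
before++x∷after x π e with dropWhile (λ y → ¬? (y ≟ x)) π in eq
before++x∷after x π refl | y ∷ post = begin
  before x π ++ x ∷ post                       ≡⟨ cong (λ z → before x π ++ z ∷ post) (sym y≡x) ⟩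
  before x π ++ y ∷ post                       ≡⟨ cong (before x π ++_) (sym eq) ⟩
  before x π ++ dropWhile (λ y → ¬? (y ≟ x)) π ≡⟨ takeWhile++dropWhile (λ y → ¬? (y ≟ x)) π ⟩
  π                                            ∎
  where
  open ≡-Reasoning
  y≡x : y ≡ x
  y≡x = decidable-stable (y ≟ x) (dropWhile-head (λ y → ¬? (y ≟ x)) π eq)

hop-if : ∀ {x π ρ} b → (b ≡ true → Hop x π ρ) → Hop x π (if b then ρ else π)
hop-if true  hop = hop refl
hop-if false _   = stay

φ′-hop : ∀ x π → Hop x π (φ′ x π)
φ′-hop x π with after x π in eq
... | nothing   = stay
... | just post = hop-if _ λ double →
  subst (λ σ → Hop x σ (exchange x (before x π) post)) (before++x∷after x π eq)
    (hop-exchange x (before x π) post double)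

Between : ℕ → ℕ → ℕ → Set
Between a d b = (a < d × d < b) ⊎ (b < d × d < a)

-- a b c d is order-isomorphic to 2413 (when a < d < b) or to 4213 (when b < d < a).
Forbidden : ℕ → ℕ → ℕ → ℕ → Set
Forbidden a b c d = c < a × c < b × Between a d b

Forbidden-swap : ∀ {a b c d} → Forbidden a b c d → Forbidden b a c d
Forbidden-swap (c<a , c<b , a-d-b) = c<b , c<a , Sum.swap a-d-b

Forbidden-lower : ∀ {a b c d y} → y ≤ c → Forbidden a b c d → Forbidden a b y d
Forbidden-lower y≤c (c<a , c<b , a-d-b) = ≤-<-trans y≤c c<a , ≤-<-trans y≤c c<b , a-d-b

Forbidden⇒c<d : ∀ {a b c d} → Forbidden a b c d → c < d
Forbidden⇒c<d (c<a , _   , inj₁ (a<d , _)) = <-trans c<a a<d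
Forbidden⇒c<d (_   , c<b , inj₂ (b<d , _)) = <-trans c<b b<d

data Occurrence (π : List ℕ) : Set where
  occurrence : ∀ {a b c d} → a ∷ b ∷ c ∷ d ∷ [] ⊆ π → Forbidden a b c d → Occurrence π

SameOrder : ℕ → ℕ → ℕ → ℕ → Set
SameOrder p q m n = ((p < q) ⇔ (m < n)) × ((q < p) ⇔ (n < m))

agree-< : ∀ {p q m n} {p<q : True (p <? q)} → m < n → SameOrder p q m n
agree-< {p<q = p<q} m<n =
  mk⇔ (λ _ → m<n) (λ _ → toWitness p<q) ,
  mk⇔ (λ q<p → ⊥-elim (<-asym (toWitness p<q) q<p)) (λ n<m → ⊥-elim (<-asym m<n n<m))

agree-> : ∀ {p q m n} {q<p : True (q <? p)} → n < m → SameOrder p q m n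
agree-> {q<p = q<p} n<m = Product.swap (agree-< {p<q = q<p} n<m)

transfer : ∀ {p q m n} → (p < q) ⇔ (m < n) → {p<q : True (p <? q)} → m < n
transfer p⇔m {p<q} = Equivalence.to p⇔m (toWitness p<q)

Occurrence⇒contains : ∀ {π} → Occurrence π →
  Contains (2 ∷ 4 ∷ 1 ∷ 3 ∷ []) π ⊎ Contains (4 ∷ 2 ∷ 1 ∷ 3 ∷ []) π
Occurrence⇒contains (occurrence p (c<a , c<b , inj₁ (a<d , d<b))) = inj₁ (_ , p ,
  (agree-< (<-trans a<d d<b) ∷ agree-> c<a ∷ agree-< a<d ∷ []) ,
  (agree-> c<b ∷ agree-> d<b ∷ []) , (agree-< (<-trans c<a a<d) ∷ []) , [] , tt)
Occurrence⇒contains (occurrence p (c<a , c<b , inj₂ (b<d , d<a))) = inj₂ (_ , p ,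
  (agree-> (<-trans b<d d<a) ∷ agree-> c<a ∷ agree-> d<a ∷ []) ,
  (agree-> c<b ∷ agree-< b<d ∷ []) , (agree-< (<-trans c<b b<d) ∷ []) , [] , tt)

contains-2413⇒Occurrence : ∀ {π} → Contains (2 ∷ 4 ∷ 1 ∷ 3 ∷ []) π → Occurrence π
contains-2413⇒Occurrence (_ ∷ _ ∷ _ ∷ _ ∷ [] , p , (_ ∷ (_ , c<a) ∷ (a<d , _) ∷ []) , ((_ , c<b) ∷ (_ , d<b) ∷ []) , _) =
  occurrence p (transfer c<a , transfer c<b , inj₁ (transfer a<d , transfer d<b))
contains-2413⇒Occurrence ([] , _ , ())
contains-2413⇒Occurrence (_ ∷ [] , _ , () , _)
contains-2413⇒Occurrence (_ ∷ _ ∷ [] , _ , (_ ∷ ()) , _)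
contains-2413⇒Occurrence (_ ∷ _ ∷ _ ∷ [] , _ , (_ ∷ _ ∷ ()) , _)
contains-2413⇒Occurrence (_ ∷ _ ∷ _ ∷ _ ∷ _ ∷ _ , _ , (_ ∷ _ ∷ _ ∷ ()) , _)

contains-4213⇒Occurrence : ∀ {π} → Contains (4 ∷ 2 ∷ 1 ∷ 3 ∷ []) π → Occurrence π
contains-4213⇒Occurrence (_ ∷ _ ∷ _ ∷ _ ∷ [] , p , (_ ∷ (_ , c<a) ∷ (_ , d<a) ∷ []) , ((_ , c<b) ∷ (b<d , _) ∷ []) , _) =
  occurrence p (transfer c<a , transfer c<b , inj₂ (transfer b<d , transfer d<a))
contains-4213⇒Occurrence ([] , _ , ())
contains-4213⇒Occurrence (_ ∷ [] , _ , () , _)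
contains-4213⇒Occurrence (_ ∷ _ ∷ [] , _ , (_ ∷ ()) , _)
contains-4213⇒Occurrence (_ ∷ _ ∷ _ ∷ [] , _ , (_ ∷ _ ∷ ()) , _)
contains-4213⇒Occurrence (_ ∷ _ ∷ _ ∷ _ ∷ _ ∷ _ , _ , (_ ∷ _ ∷ _ ∷ ()) , _)

Av⇒¬Occurrence : ∀ {π} → Av-2413-4213 π → ¬ Occurrence π
Av⇒¬Occurrence (¬2413 , ¬4213) occ with Occurrence⇒contains occ
... | inj₁ c = ¬2413 c
... | inj₂ c = ¬4213 c

¬Occurrence⇒Av : ∀ {π} → ¬ Occurrence π → Av-2413-4213 π
¬Occurrence⇒Av ¬occ = ¬occ ∘ contains-2413⇒Occurrence , ¬occ ∘ contains-4213⇒Occurrence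

data RightHopView (x : ℕ) (u B v w : List ℕ) : Set where
  unaffected : w ⊆ u ++ x ∷ B ++ v → RightHopView x u B v w
  crossing   : ∀ w₁ e w₂ w₄ → w ≡ w₁ ++ e ∷ w₂ ++ x ∷ w₄ →
               w₁ ⊆ u → e ∷ w₂ ⊆ B → w₄ ⊆ v → RightHopView x u B v w

rightHopView : ∀ x u B v {w} → w ⊆ u ++ B ++ x ∷ v → RightHopView x u B v w
rightHopView x u B v p with ⊆-++⁻ u p
... | w₁ , _ , refl , s₁ , q with ⊆-++⁻ B q
...   | w₂ , _ , refl , s₂ , (.x ∷ʳ s₄) = unaffected (++⁺ s₁ (x ∷ʳ ++⁺ s₂ s₄))
...   | []     , _ , refl , s₂ , (refl ∷ s₄) = unaffected (++⁺ s₁ (refl ∷ ++⁺ s₂ s₄))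
...   | e ∷ w₂ , _ , refl , s₂ , (refl ∷ s₄) = crossing w₁ e w₂ _ refl s₁ s₂ s₄

data LeftHopView (x : ℕ) (u B v w : List ℕ) : Set where
  unaffected : w ⊆ u ++ B ++ x ∷ v → LeftHopView x u B v w
  crossing   : ∀ w₁ e w₂ w₄ → w ≡ w₁ ++ x ∷ e ∷ w₂ ++ w₄ →
               w₁ ⊆ u → e ∷ w₂ ⊆ B → w₄ ⊆ v → LeftHopView x u B v w

leftHopView : ∀ x u B v {w} → w ⊆ u ++ x ∷ B ++ v → LeftHopView x u B v w
leftHopView x u B v p with ⊆-++⁻ u p
... | w₁ , _ , refl , s₁ , (.x ∷ʳ q) with ⊆-++⁻ B q
...   | w₂ , w₄ , refl , s₂ , s₄ = unaffected (++⁺ s₁ (++⁺ s₂ (x ∷ʳ s₄)))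
leftHopView x u B v p | w₁ , _ , refl , s₁ , (refl ∷ q) with ⊆-++⁻ B q
...   | []     , w₄ , refl , s₂ , s₄ = unaffected (++⁺ s₁ (++⁺ s₂ (refl ∷ s₄)))
...   | e ∷ w₂ , w₄ , refl , s₂ , s₄ = crossing w₁ e w₂ w₄ refl s₁ s₂ s₄

replace-by-head : ∀ {x u B v w₁ w₂ d} → w₁ ⊆ u → w₂ ⊆ B → d ∷ [] ⊆ v → x < d → StartsAtMost x v →
  ∃ λ y → y ≤ x × w₁ ++ w₂ ++ y ∷ d ∷ [] ⊆ u ++ x ∷ B ++ v
replace-by-head     _  _  ()         _   []
replace-by-head {x} s₁ s₂ (_ ∷ʳ s₄)  _   (y≤x ∷ _) = _ , y≤x , ++⁺ s₁ (x ∷ʳ ++⁺ s₂ (refl ∷ s₄))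
replace-by-head     _  _  (refl ∷ _) x<d (d≤x ∷ _) = ⊥-elim (≤⇒≯ d≤x x<d)

replace-by-last : ∀ {x u B v a b d} → a ∷ b ∷ [] ⊆ u → d ∷ [] ⊆ B → x < b → EndsAtMost x u →
  ∃ λ z → z ≤ x × a ∷ b ∷ z ∷ d ∷ [] ⊆ u ++ B ++ x ∷ v
replace-by-last ()      _  _   []
replace-by-last {a = a} s₁ s₂ x<b (_ ∷ʳ z≤x) =
  _ , z≤x , ++⁺ (++⁺ (⊆-∷ʳ⁻ {xs = a ∷ []} (λ { refl → ≤⇒≯ z≤x x<b }) s₁) (refl ∷ [])) (++⁺ s₂ (minimum _))

-- x is the second letter, the third (c), or the fourth, which is impossible since c < d.
crossingʳ : ∀ {x u B v a b c d} w₁ e w₂ w₄ → a ∷ b ∷ c ∷ d ∷ [] ≡ w₁ ++ e ∷ w₂ ++ x ∷ w₄ →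
  w₁ ⊆ u → e ∷ w₂ ⊆ B → w₄ ⊆ v → All (x <_) (e ∷ w₂) → StartsAtMost x v → Forbidden a b c d →
  Occurrence (u ++ x ∷ B ++ v)
crossingʳ [] _ [] _ refl s₁ s₂ s₄ _ _ f = occurrence (++⁺ s₁ (refl ∷ ++⁺ s₂ s₄)) (Forbidden-swap f)
crossingʳ [] _ (_ ∷ []) _ refl s₁ s₂ s₄ _ v≤x f with replace-by-head s₁ s₂ s₄ (Forbidden⇒c<d f) v≤x
... | _ , y≤c , s = occurrence s (Forbidden-lower y≤c f)
crossingʳ (_ ∷ []) _ [] _ refl s₁ s₂ s₄ _ v≤x f with replace-by-head s₁ s₂ s₄ (Forbidden⇒c<d f) v≤x
... | _ , y≤c , s = occurrence s (Forbidden-lower y≤c f)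
crossingʳ [] _ (_ ∷ _ ∷ []) _ refl _ _ _ (_ ∷ _ ∷ d<c ∷ []) _ f = ⊥-elim (<-asym d<c (Forbidden⇒c<d f))
crossingʳ (_ ∷ []) _ (_ ∷ []) _ refl _ _ _ (_ ∷ d<c ∷ []) _ f = ⊥-elim (<-asym d<c (Forbidden⇒c<d f))
crossingʳ (_ ∷ _ ∷ []) _ [] _ refl _ _ _ (d<c ∷ []) _ f = ⊥-elim (<-asym d<c (Forbidden⇒c<d f))
crossingʳ []                    _ (_ ∷ _ ∷ _ ∷ [])    _ () _ _ _ _ _ _
crossingʳ []                    _ (_ ∷ _ ∷ _ ∷ _ ∷ _) _ () _ _ _ _ _ _
crossingʳ (_ ∷ [])              _ (_ ∷ _ ∷ [])        _ () _ _ _ _ _ _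
crossingʳ (_ ∷ [])              _ (_ ∷ _ ∷ _ ∷ _)     _ () _ _ _ _ _ _
crossingʳ (_ ∷ _ ∷ [])          _ (_ ∷ [])            _ () _ _ _ _ _ _
crossingʳ (_ ∷ _ ∷ [])          _ (_ ∷ _ ∷ _)         _ () _ _ _ _ _ _
crossingʳ (_ ∷ _ ∷ _ ∷ [])      _ []                  _ () _ _ _ _ _ _
crossingʳ (_ ∷ _ ∷ _ ∷ [])      _ (_ ∷ _)             _ () _ _ _ _ _ _
crossingʳ (_ ∷ _ ∷ _ ∷ _ ∷ [])  _ _                   _ () _ _ _ _ _ _
crossingʳ (_ ∷ _ ∷ _ ∷ _ ∷ _ ∷ _) _ _                 _ () _ _ _ _ _ _

-- x is the first letter, the third (c), or the second, which is impossible since c < b.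
crossingˡ : ∀ {x u B v a b c d} w₁ e w₂ w₄ → a ∷ b ∷ c ∷ d ∷ [] ≡ w₁ ++ x ∷ e ∷ w₂ ++ w₄ →
  w₁ ⊆ u → e ∷ w₂ ⊆ B → w₄ ⊆ v → All (x <_) (e ∷ w₂) → EndsAtMost x u → Forbidden a b c d →
  Occurrence (u ++ B ++ x ∷ v)
crossingˡ [] _ [] _ refl s₁ s₂ s₄ _ _ f = occurrence (++⁺ s₁ (++⁺ s₂ (refl ∷ s₄))) (Forbidden-swap f)
crossingˡ [] _ (_ ∷ []) _ refl _ _ _ (_ ∷ a<c ∷ _) _ (c<a , _) = ⊥-elim (<-asym a<c c<a)
crossingˡ [] _ (_ ∷ _ ∷ []) _ refl _ _ _ (_ ∷ a<c ∷ _) _ (c<a , _) = ⊥-elim (<-asym a<c c<a)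
crossingˡ (_ ∷ []) _ [] _ refl _ _ _ (b<c ∷ _) _ (_ , c<b , _) = ⊥-elim (<-asym b<c c<b)
crossingˡ (_ ∷ []) _ (_ ∷ []) _ refl _ _ _ (b<c ∷ _) _ (_ , c<b , _) = ⊥-elim (<-asym b<c c<b)
crossingˡ (_ ∷ _ ∷ []) _ [] _ refl s₁ s₂ _ _ u≤x f@(_ , c<b , _) with replace-by-last s₁ s₂ c<b u≤x
... | _ , z≤c , s = occurrence s (Forbidden-lower z≤c f)
crossingˡ []                    _ (_ ∷ _ ∷ _ ∷ _) _ () _ _ _ _ _ _
crossingˡ (_ ∷ [])              _ (_ ∷ _ ∷ _)     _ () _ _ _ _ _ _
crossingˡ (_ ∷ _ ∷ [])          _ (_ ∷ _)         _ () _ _ _ _ _ _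
crossingˡ (_ ∷ _ ∷ _ ∷ [])      _ _               _ () _ _ _ _ _ _
crossingˡ (_ ∷ _ ∷ _ ∷ _ ∷ [])  _ _               _ () _ _ _ _ _ _
crossingˡ (_ ∷ _ ∷ _ ∷ _ ∷ _ ∷ _) _ _             _ () _ _ _ _ _ _

hop-reflects-Occurrence : ∀ {x π ρ} → Hop x π ρ → Occurrence ρ → Occurrence π
hop-reflects-Occurrence stay occ = occ
hop-reflects-Occurrence {x} (right u B v B>x v≤x) (occurrence p f) with rightHopView x u B v p
... | unaffected q = occurrence q f
... | crossing w₁ e w₂ w₄ eq s₁ s₂ s₄ = crossingʳ w₁ e w₂ w₄ eq s₁ s₂ s₄ (All-resp-⊆ s₂ B>x) v≤x f
hop-reflects-Occurrence {x} (left u B v B>x u≤x) (occurrence p f) with leftHopView x u B v p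
... | unaffected q = occurrence q f
... | crossing w₁ e w₂ w₄ eq s₁ s₂ s₄ = crossingˡ w₁ e w₂ w₄ eq s₁ s₂ s₄ (All-resp-⊆ s₂ B>x) u≤x f

lemma4p8 : (n : ℕ) (π : List ℕ) → IsPerm n π → Av-2413-4213 π →
    (x : ℕ) → 1 ≤ x → x ≤ n →
    IsPerm n (φ′ x π) × Av-2413-4213 (φ′ x π)
lemma4p8 n π π↭[1‥n] avoids x _ _ =
  ↭-trans (Hop⇒↭ hop) π↭[1‥n] , ¬Occurrence⇒Av (Av⇒¬Occurrence avoids ∘ hop-reflects-Occurrence hop)
  where
  hop = φ′-hop x π
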